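{- Let $\mathbf t:\mathcal D\to\mathcal T$ be a functor, $c:A\to B$ a morphism of $\mathcal T$ and $Q\sqsubset B$. Whenever the pullback $c^*Q$ exists in $\mathbf t$, there is a natural isomorphism $(c^*Q)^+\cong(c^+)^*Q^+=Q^+\circ(c^+)^{op}$ of presheaves on $A^+$.
   Context: Write $P\sqsubset A$ if $\mathbf t(P)=A$; composition is diagrammatic ($c;d$ = $c$ then $d$); a derivation $\alpha:P\Rightarrow_c Q$ is a morphism of $\mathcal D$ with $\mathbf t(\alpha)=c$. A pullback of $Q\sqsubset B$ along $c:A\to B$ is $c^*Q\sqsubset A$ with a derivation $\ell:c^*Q\Rightarrow_c Q$ such that for all $P\sqsubset Z$, $d:Z\to A$, $\eta\mapsto\eta;\ell$ is a bijection from derivations $P\Rightarrow_d c^*Q$ to derivations $P\Rightarrow_{d;c}Q$. For a type $B$, $B^+$ is the category with objects $(P,c)$, $P\sqsubset A$, $c:A\to B$, and morphisms $(P_1,c_1)\to(P_2,c_2)$ the derivations $\alpha:P_1\Rightarrow_e P_2$ with $c_1=e;c_2$. For $c:A\to B$, $c^+:A^+\to B^+$ sends $(P,d)\mapsto(P,d;c)$, $\alpha\mapsto\alpha$. For $Q\sqsubset B$, $Q^+:(B^+)^{op}\to\mathbf{Set}$ sends $(P,c)$ to the set of derivations $P\Rightarrow_c Q$, with morphisms acting by precomposition. -}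

module Defs where

open import Level using (Level; _⊔_; suc)
open import Data.Product using (Σ; _,_; proj₁; proj₂)
open import Relation.Binary.Core using (Rel)
open import Relation.Binary.Structures using (IsEquivalence)
open import Relation.Binary.Bundles using (Setoid)
import Relation.Binary.Reasoning.Setoid as SetoidR

-- Categories with hom-setoids; composition is diagrammatic: f ⨾ g = f then g.
record Category (o ℓ e : Level) : Set (suc (o ⊔ ℓ ⊔ e)) where
  infixr 9 _⨾_
  infix 4 _≈_
  field
    Obj   : Set o
    Hom   : Obj → Obj → Set ℓ
    _≈_   : ∀ {A B} → Rel (Hom A B) e
    equiv : ∀ {A B} → IsEquivalence (_≈_ {A} {B})
    id    : ∀ {A} → Hom A A
    _⨾_   : ∀ {A B C} → Hom A B → Hom B C → Hom A C
    ⨾-resp : ∀ {A B C} {f f' : Hom A B} {g g' : Hom B C} →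
             f ≈ f' → g ≈ g' → (f ⨾ g) ≈ (f' ⨾ g')
    idˡ   : ∀ {A B} {f : Hom A B} → (id ⨾ f) ≈ f
    idʳ   : ∀ {A B} {f : Hom A B} → (f ⨾ id) ≈ f
    assoc : ∀ {A B C D} {f : Hom A B} {g : Hom B C} {h : Hom C D} →
            ((f ⨾ g) ⨾ h) ≈ (f ⨾ (g ⨾ h))

  homSetoid : Obj → Obj → Setoid ℓ e
  homSetoid A B = record { Carrier = Hom A B ; _≈_ = _≈_ ; isEquivalence = equiv }

  module _ {A B : Obj} where
    open IsEquivalence (equiv {A} {B}) public
      using () renaming (refl to ≈refl; sym to ≈sym; trans to ≈trans)

record Functor {o ℓ e o' ℓ' e'} (C : Category o ℓ e) (D : Category o' ℓ' e')
       : Set (o ⊔ ℓ ⊔ e ⊔ o' ⊔ ℓ' ⊔ e') where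
  private
    module C = Category C
    module D = Category D
  field
    F₀     : C.Obj → D.Obj
    F₁     : ∀ {A B} → C.Hom A B → D.Hom (F₀ A) (F₀ B)
    F-resp : ∀ {A B} {f g : C.Hom A B} → f C.≈ g → F₁ f D.≈ F₁ g
    F-id   : ∀ {A} → F₁ (C.id {A}) D.≈ D.id
    F-comp : ∀ {A B C'} {f : C.Hom A B} {g : C.Hom B C'} →
             F₁ (f C.⨾ g) D.≈ (F₁ f D.⨾ F₁ g)

record Presheaf {o ℓ e} (C : Category o ℓ e) (p q : Level)
       : Set (o ⊔ ℓ ⊔ e ⊔ suc (p ⊔ q)) where
  private module C = Category C
  field
    F₀ : C.Obj → Setoid p q
  open module S (X : C.Obj) = Setoid (F₀ X) using (Carrier)
  field
    act       : ∀ {X Y} → C.Hom X Y → Carrier Y → Carrier X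
    act-cong  : ∀ {X Y} (f : C.Hom X Y) {x y : Carrier Y} →
                Setoid._≈_ (F₀ Y) x y → Setoid._≈_ (F₀ X) (act f x) (act f y)
    act-resp  : ∀ {X Y} {f g : C.Hom X Y} → f C.≈ g → (x : Carrier Y) →
                Setoid._≈_ (F₀ X) (act f x) (act g x)
    act-id    : ∀ {X} (x : Carrier X) → Setoid._≈_ (F₀ X) (act C.id x) x
    act-comp  : ∀ {X Y Z} (f : C.Hom X Y) (g : C.Hom Y Z) (x : Carrier Z) →
                Setoid._≈_ (F₀ X) (act (f C.⨾ g) x) (act f (act g x))

_∘op_ : ∀ {o ℓ e o' ℓ' e' p q} {C : Category o ℓ e} {D : Category o' ℓ' e'} →
        Presheaf D p q → Functor C D → Presheaf C p q
_∘op_ {D = D} F G = record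
  { F₀       = λ X → F.F₀ (G.F₀ X)
  ; act      = λ f → F.act (G.F₁ f)
  ; act-cong = λ f → F.act-cong (G.F₁ f)
  ; act-resp = λ f≈g → F.act-resp (G.F-resp f≈g)
  ; act-id   = λ {X} x → Setoid.trans (F.F₀ (G.F₀ X)) (F.act-resp G.F-id x) (F.act-id x)
  ; act-comp = λ {X} f g x → Setoid.trans (F.F₀ (G.F₀ X)) (F.act-resp G.F-comp x)
                                 (F.act-comp (G.F₁ f) (G.F₁ g) x)
  }
  where
    module F = Presheaf F
    module G = Functor G

record NatIso {o ℓ e p q} {C : Category o ℓ e} (F G : Presheaf C p q)
       : Set (o ⊔ ℓ ⊔ e ⊔ p ⊔ q) where
  private
    module C = Category C
    module F = Presheaf F
    module G = Presheaf G
  field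
    η       : ∀ X → Setoid.Carrier (F.F₀ X) → Setoid.Carrier (G.F₀ X)
    η⁻¹     : ∀ X → Setoid.Carrier (G.F₀ X) → Setoid.Carrier (F.F₀ X)
    η-cong  : ∀ X {x y} → Setoid._≈_ (F.F₀ X) x y → Setoid._≈_ (G.F₀ X) (η X x) (η X y)
    η⁻¹-cong : ∀ X {x y} → Setoid._≈_ (G.F₀ X) x y → Setoid._≈_ (F.F₀ X) (η⁻¹ X x) (η⁻¹ X y)
    iso₁    : ∀ X x → Setoid._≈_ (F.F₀ X) (η⁻¹ X (η X x)) x
    iso₂    : ∀ X y → Setoid._≈_ (G.F₀ X) (η X (η⁻¹ X y)) y
    natural : ∀ {X Y} (f : C.Hom X Y) (x : Setoid.Carrier (F.F₀ Y)) →
              Setoid._≈_ (G.F₀ X) (η X (F.act f x)) (G.act f (η Y x))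

module Over {o ℓ e o' ℓ' e'} {𝒟 : Category o ℓ e} {𝒯 : Category o' ℓ' e'}
            (t : Functor 𝒟 𝒯) where
  private
    module D = Category 𝒟
    module T = Category 𝒯
  open Functor t

  _⊏_ : D.Obj → T.Obj → Set o'
  P ⊏ A = F₀ P ≡' A
    where open import Relation.Binary.PropositionalEquality using () renaming (_≡_ to _≡'_)

  -- derivations α : P ⇒[ c ] Q, i.e. morphisms α of 𝒟 with t(α) = c
  -- (here P ⊏ t(P) and Q ⊏ t(Q) by definition)
  Deriv : (P Q : D.Obj) → T.Hom (F₀ P) (F₀ Q) → Set (ℓ ⊔ e')
  Deriv P Q c = Σ (D.Hom P Q) (λ α → F₁ α T.≈ c)

  DerivSetoid : (P Q : D.Obj) → T.Hom (F₀ P) (F₀ Q) → Setoid (ℓ ⊔ e') e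
  DerivSetoid P Q c = record
    { Carrier = Deriv P Q c
    ; _≈_ = λ x y → proj₁ x D.≈ proj₁ y
    ; isEquivalence = record { refl = D.≈refl ; sym = D.≈sym ; trans = D.≈trans } }

  _⊙_ : ∀ {P R Q} {d : T.Hom (F₀ P) (F₀ R)} {c : T.Hom (F₀ R) (F₀ Q)} →
        Deriv P R d → Deriv R Q c → Deriv P Q (d T.⨾ c)
  (η , p) ⊙ (l , q) = (η D.⨾ l) , T.≈trans F-comp (T.⨾-resp p q)

  -- ℓ : R ⇒[ c ] Q exhibits R as a pullback c^*Q of Q along c (R ⊏ A := t(R)):
  -- for all P ⊏ Z and d : Z → A, η ↦ η ⨾ ℓ is a bijection from
  -- derivations P ⇒[ d ] R to derivations P ⇒[ d ⨾ c ] Q.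
  record IsPullback {R Q : D.Obj} {c : T.Hom (F₀ R) (F₀ Q)} (l : Deriv R Q c)
         : Set (o ⊔ ℓ ⊔ e ⊔ ℓ' ⊔ e') where
    field
      injective  : ∀ {P} {d : T.Hom (F₀ P) (F₀ R)} (η η' : Deriv P R d) →
                   proj₁ (η ⊙ l) D.≈ proj₁ (η' ⊙ l) → proj₁ η D.≈ proj₁ η'
      surjective : ∀ {P} {d : T.Hom (F₀ P) (F₀ R)} (θ : Deriv P Q (d T.⨾ c)) →
                   Σ (Deriv P R d) (λ η → proj₁ (η ⊙ l) D.≈ proj₁ θ)

  Plus : T.Obj → Category (o ⊔ ℓ') (ℓ ⊔ e') e
  Plus B = record
    { Obj   = Σ D.Obj (λ P → T.Hom (F₀ P) B)
    ; Hom   = λ { (P₁ , c₁) (P₂ , c₂) → Σ (D.Hom P₁ P₂) (λ α → c₁ T.≈ (F₁ α T.⨾ c₂)) }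
    ; _≈_   = λ x y → proj₁ x D.≈ proj₁ y
    ; equiv = record { refl = D.≈refl ; sym = D.≈sym ; trans = D.≈trans }
    ; id    = λ { {P , c} → D.id , T.≈sym (T.≈trans (T.⨾-resp F-id T.≈refl) T.idˡ) }
    ; _⨾_   = λ { {P₁ , c₁} {P₂ , c₂} {P₃ , c₃} (α , p) (β , q) →
                  (α D.⨾ β) ,
                  T.≈trans p (T.≈trans (T.⨾-resp T.≈refl q)
                    (T.≈trans (T.≈sym T.assoc) (T.⨾-resp (T.≈sym F-comp) T.≈refl))) }
    ; ⨾-resp = D.⨾-resp
    ; idˡ   = D.idˡ
    ; idʳ   = D.idʳ
    ; assoc = D.assoc
    }

  _⁺ᶠ : ∀ {A B} → T.Hom A B → Functor (Plus A) (Plus B)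
  c ⁺ᶠ = record
    { F₀ = λ { (P , d) → P , (d T.⨾ c) }
    ; F₁ = λ { (α , p) → α , T.≈trans (T.⨾-resp p T.≈refl) T.assoc }
    ; F-resp = λ x → x
    ; F-id = D.≈refl
    ; F-comp = D.≈refl
    }

  _⁺ᵖ : (Q : D.Obj) → Presheaf (Plus (F₀ Q)) (ℓ ⊔ e') e
  Q ⁺ᵖ = record
    { F₀ = λ { (P , c) → DerivSetoid P Q c }
    ; act = λ { {P₁ , c₁} {P₂ , c₂} (α , p) (β , q) →
                (α D.⨾ β) , T.≈trans F-comp (T.≈trans (T.⨾-resp T.≈refl q) (T.≈sym p)) }
    ; act-cong = λ f x≈y → D.⨾-resp D.≈refl x≈y
    ; act-resp = λ f≈g x → D.⨾-resp f≈g D.≈refl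
    ; act-id   = λ x → D.idˡ
    ; act-comp = λ f g x → D.assoc
    }

-- The universal property of ℓ : c^*Q ⇒_c Q says that, for every object (P , d) of A⁺,
-- postcomposition with ℓ is a bijection from (c^*Q)⁺(P , d) = {P ⇒_d c^*Q} onto
-- Q⁺(P , d ; c) = ((c⁺)^* Q⁺)(P , d). A bijection of setoids has a congruent inverse,
-- and naturality in (P , d) is associativity of composition in 𝒟.
module Submission where

open import Defs
open import Data.Product using (_,_; proj₁; proj₂)
open import Function.Bundles using (Bijection; Inverse)
open import Function.Consequences using (strictlySurjective⇒surjective)
open import Function.Properties.Bijection using (Bijection⇒Inverse)
open import Relation.Binary.Bundles using (module Setoid)

module _ {o ℓ e o' ℓ' e'} {𝒟 : Category o ℓ e} {𝒯 : Category o' ℓ' e'}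
         (t : Functor 𝒟 𝒯) where
  private
    module D = Category 𝒟
    module T = Category 𝒯
  open Functor t using (F₀)
  open Over t

  IsPullback⇒postcomposition-bijection :
    ∀ {R Q} {c : T.Hom (F₀ R) (F₀ Q)} {l : Deriv R Q c} → IsPullback l →
    ∀ {P} {d : T.Hom (F₀ P) (F₀ R)} →
    Bijection (DerivSetoid P R d) (DerivSetoid P Q (d T.⨾ c))
  IsPullback⇒postcomposition-bijection {R} {Q} {c} {l} pb {P} {d} = record
    { to        = _⊙ l
    ; cong      = λ {η} {η'} → ⊙l-cong {η} {η'}
    ; bijective = (λ {η} {η'} → injective {P} {d} η η')
                , strictlySurjective⇒surjective
                    {≈₂ = _≈_ (DerivSetoid P Q (d T.⨾ c))} {f = _⊙ l} D.≈trans (λ {η} {η'} → ⊙l-cong {η} {η'}) surjective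
    }
    where
      open IsPullback pb
      open Setoid using (_≈_)
      ⊙l-cong : ∀ {η η' : Deriv P R d} →
                proj₁ η D.≈ proj₁ η' → proj₁ (η ⊙ l) D.≈ proj₁ (η' ⊙ l)
      ⊙l-cong η≈η' = D.⨾-resp η≈η' D.≈refl

proposition3p18 : ∀ {o ℓ e o' ℓ' e'} {𝒟 : Category o ℓ e} {𝒯 : Category o' ℓ' e'}
    (t : Functor 𝒟 𝒯) (R Q : Category.Obj 𝒟)
    (c : Category.Hom 𝒯 (Functor.F₀ t R) (Functor.F₀ t Q))
    (l : Over.Deriv t R Q c) →
    Over.IsPullback t l →
    NatIso (Over._⁺ᵖ t R) (Over._⁺ᵖ t Q ∘op Over._⁺ᶠ t c)
proposition3p18 {𝒟 = 𝒟} t R Q c l pb = record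
  { η        = λ X → to {X}
  ; η⁻¹      = λ X → from {X}
  ; η-cong   = λ X {x} {y} → to-cong {X} {x} {y}
  ; η⁻¹-cong = λ X {x} {y} → from-cong {X} {x} {y}
  ; iso₁     = λ X → strictlyInverseʳ {X}
  ; iso₂     = λ X → strictlyInverseˡ {X}
  ; natural  = λ _ _ → Category.assoc 𝒟
  }
  where
    open module Fibre {X : Category.Obj (Over.Plus t (Functor.F₀ t R))} = Inverse
      (Bijection⇒Inverse (IsPullback⇒postcomposition-bijection t pb {proj₁ X} {proj₂ X}))
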